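{- For every integer $n\ge5$, $$\sum_{\ell=1}^{n-1}\frac{A(n-1,\ell-1)}{(n-1)!}\,\ell\,(n-2\ell)\,(n^2-4n\ell+4\ell^2-n)=\frac{n}{15}.$$
   Context: $A(m,k)$ denotes the Eulerian number: the number of permutations $\sigma$ of $\{1,\dots,m\}$ with exactly $k$ ascents, i.e. exactly $k$ indices $i$ with $\sigma(i)<\sigma(i+1)$. -}

module Defs where

open import Data.Nat using (ℕ; zero; suc; _<ᵇ_; _+_)
open import Data.Bool using (Bool; true; false; if_then_else_)
open import Data.List using (List; []; _∷_; concatMap; map; length; filter; upTo)
open import Data.Nat.Properties using (_≟_)
open import Relation.Nullary.Decidable using (⌊_⌋)

insertions : ℕ → List ℕ → List (List ℕ)
insertions x []       = (x ∷ []) ∷ []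
insertions x (y ∷ ys) = (x ∷ y ∷ ys) ∷ map (y ∷_) (insertions x ys)

-- Each permutation occurs exactly once.
perms : ℕ → List (List ℕ)
perms zero    = [] ∷ []
perms (suc m) = concatMap (insertions (suc m)) (perms m)

ascents : List ℕ → ℕ
ascents []           = 0
ascents (x ∷ [])     = 0
ascents (x ∷ y ∷ ys) = (if x <ᵇ y then 1 else 0) + ascents (y ∷ ys)

A : ℕ → ℕ → ℕ
A m k = length (filter (λ σ → ascents σ ≟ k) (perms m))

{-# OPTIONS --safe #-}
-- Put m = n − 1 and, for a permutation of {1,…,m} with a ascents, ℓ = a + 1 and y = n − 2ℓ;
-- the summand is then ℓ·y·(y² − n), so the left-hand side is the average of this quantity
-- over all permutations of {1,…,m}. Inserting m + 1 into a permutation of {1,…,m} keeps the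
-- number of ascents in a + 1 ways and raises it by one in m − a ways, i.e. y becomes y + 1 in
-- (n − y)/2 ways and y − 1 in (n + y)/2 ways. For φ₂ = 3y² − n, φ₃ = y³ − ny and
-- φ₄ = 15y⁴ − 30ny² + 5n² + 2n this step multiplies the sum of φₖ over all permutations by
-- n − k, so these sums vanish as soon as n > k. Since 30·ℓ·y·(y² − n) = 2n + 15n·φ₃ − 5n·φ₂ − φ₄,
-- the sum of the summands over all m! permutations is n·m!/15.
module Submission where

open import Defs
open import Data.Bool using (true; false; if_then_else_)
open import Data.Bool.Properties using (T-≡; ¬-not)
open import Data.Integer as ℤ using (ℤ; +_; 0ℤ; 1ℤ)
open import Data.Integer.Properties
  using (+-identityˡ; +-identityʳ; +-assoc; *-assoc; *-comm; *-zeroʳ; *-distribˡ-+; pos-*; *-cancelˡ-≡; +-inverseʳ)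
open import Data.Integer.Tactic.RingSolver using (solve-∀)
open import Data.List using (List; []; _∷_; _++_; concat; map; length; filter; foldr; upTo; applyUpTo)
open import Data.List.Properties using (map-applyUpTo; map-cong)
open import Data.List.Relation.Unary.All as All using (All; []; _∷_)
open import Data.List.Relation.Unary.All.Properties using (concat⁺; map⁺)
open import Data.Nat as ℕ using (ℕ; zero; suc; _<_; _≤_; _<ᵇ_; _∸_; _!; s≤s; z≤n; s≤s⁻¹; NonZero) renaming (_*_ to _*ℕ_)
open import Data.Nat.Properties
  using (≤-trans; <⇒<ᵇ; <ᵇ⇒<; <-asym; m<n⇒m<1+n; n<1+n; m≤n⇒m<n∨m≡n; _≟_; _!≢0)
  renaming (*-identityʳ to ℕ-*-identityʳ)
open import Data.Product using (_×_; _,_)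
open import Data.Rational using (_/_; 0ℚ; toℚᵘ)
open import Data.Rational.Properties using (toℚᵘ-injective; toℚᵘ-fromℚᵘ; toℚᵘ-homo-+; toℚᵘ-homo-*; toℚᵘ-homo‿-; 0/n≡0; /-cong)
open import Data.Rational.Unnormalised using (mkℚᵘ; *≡*) renaming (_≃_ to _≃ᵘ_)
open import Data.Rational.Unnormalised.Properties as ℚᵘ using (≃-trans; ≃-sym)
open import Data.Sum using (inj₁; inj₂)
open import Function using (_∘_; id)
open import Function.Bundles using (Equivalence)
open import Relation.Nullary using (does)
open import Relation.Binary.PropositionalEquality
open ≡-Reasoning

-- Integer arithmetic is opened only inside this module, since the theorem uses the rational
-- operators of the same names.
module AscentSums where

  open import Data.Integer using (_+_; _-_; _*_; -_)

  ∑ : {A : Set} → List A → (A → ℤ) → ℤ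
  ∑ []       f = 0ℤ
  ∑ (x ∷ xs) f = f x + ∑ xs f

  syntax ∑ xs (λ x → e) = ∑[ x ∈ xs ] e

  module _ {A : Set} where

    ∑-cong-local : ∀ {xs : List A} {f g : A → ℤ} → All (λ x → f x ≡ g x) xs → ∑ xs f ≡ ∑ xs g
    ∑-cong-local []            = refl
    ∑-cong-local (fx≡gx ∷ eqs) = cong₂ _+_ fx≡gx (∑-cong-local eqs)

    ∑-cong : ∀ (xs : List A) {f g : A → ℤ} → (∀ x → f x ≡ g x) → ∑ xs f ≡ ∑ xs g
    ∑-cong xs f≗g = ∑-cong-local (All.universal f≗g xs)

    ∑-zero : ∀ (xs : List A) → ∑[ x ∈ xs ] 0ℤ ≡ 0ℤ
    ∑-zero []       = refl
    ∑-zero (x ∷ xs) = trans (+-identityˡ _) (∑-zero xs)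

    ∑-+ : ∀ (xs : List A) (f g : A → ℤ) → ∑[ x ∈ xs ] (f x + g x) ≡ ∑ xs f + ∑ xs g
    ∑-+ []       f g = refl
    ∑-+ (x ∷ xs) f g = trans (cong (_+_ (f x + g x)) (∑-+ xs f g)) (interchange (f x) (g x) _ _)
      where
      interchange : ∀ a b c d → (a + b) + (c + d) ≡ (a + c) + (b + d)
      interchange = solve-∀

    ∑-*ˡ : ∀ (xs : List A) (c : ℤ) (f : A → ℤ) → ∑[ x ∈ xs ] (c * f x) ≡ c * ∑ xs f
    ∑-*ˡ []       c f = sym (*-zeroʳ c)
    ∑-*ˡ (x ∷ xs) c f = trans (cong (_+_ (c * f x)) (∑-*ˡ xs c f)) (sym (*-distribˡ-+ c (f x) (∑ xs f)))

    ∑-+-*-vanishing : ∀ (xs : List A) (f g : A → ℤ) (c : ℤ) → ∑ xs g ≡ 0ℤ →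
                      ∑[ x ∈ xs ] (f x + c * g x) ≡ ∑ xs f
    ∑-+-*-vanishing xs f g c ∑g≡0 = begin
      ∑[ x ∈ xs ] (f x + c * g x)     ≡⟨ ∑-+ xs f (λ x → c * g x) ⟩
      ∑ xs f + ∑[ x ∈ xs ] (c * g x)  ≡⟨ cong (_+_ (∑ xs f)) (trans (∑-*ˡ xs c g) (cong (c *_) ∑g≡0)) ⟩
      ∑ xs f + c * 0ℤ                 ≡⟨ cong (_+_ (∑ xs f)) (*-zeroʳ c) ⟩
      ∑ xs f + 0ℤ                     ≡⟨ +-identityʳ _ ⟩
      ∑ xs f                          ∎

    ∑-++ : ∀ (xs ys : List A) (f : A → ℤ) → ∑ (xs ++ ys) f ≡ ∑ xs f + ∑ ys f
    ∑-++ []       ys f = sym (+-identityˡ _)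
    ∑-++ (x ∷ xs) ys f = trans (cong (_+_ (f x)) (∑-++ xs ys f)) (sym (+-assoc (f x) _ _))

    ∑-concat : ∀ (xss : List (List A)) (f : A → ℤ) → ∑ (concat xss) f ≡ ∑[ xs ∈ xss ] ∑ xs f
    ∑-concat []         f = refl
    ∑-concat (xs ∷ xss) f = trans (∑-++ xs (concat xss) f) (cong (_+_ (∑ xs f)) (∑-concat xss f))

  ∑-map : ∀ {A B : Set} (g : A → B) (xs : List A) (f : B → ℤ) → ∑ (map g xs) f ≡ ∑[ x ∈ xs ] f (g x)
  ∑-map g []       f = refl
  ∑-map g (x ∷ xs) f = cong (_+_ (f (g x))) (∑-map g xs f)

  ∑-upTo-suc : ∀ k (h : ℕ → ℤ) → ∑ (upTo (suc k)) h ≡ h 0 + ∑[ i ∈ upTo k ] h (suc i)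
  ∑-upTo-suc k h = cong (_+_ (h 0)) (begin
    ∑ (applyUpTo suc k) h       ≡⟨ cong (λ is → ∑ is h) (map-applyUpTo id suc k) ⟨
    ∑ (map suc (upTo k)) h      ≡⟨ ∑-map suc (upTo k) h ⟩
    ∑[ i ∈ upTo k ] h (suc i)   ∎)

  ∑-upTo-indicator : ∀ k {j} (f : ℕ → ℤ) → j < k → ∑[ i ∈ upTo k ] (if does (j ≟ i) then f i else 0ℤ) ≡ f j
  ∑-upTo-indicator (suc k) {zero}  f _ =
    trans (∑-upTo-suc k (λ i → if does (0 ≟ i) then f i else 0ℤ))
          (trans (cong (_+_ (f 0)) (∑-zero (upTo k))) (+-identityʳ (f 0)))
  ∑-upTo-indicator (suc k) {suc j} f (s≤s j<k) =
    trans (∑-upTo-suc k (λ i → if does (suc j ≟ i) then f i else 0ℤ))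
          (trans (+-identityˡ _) (∑-upTo-indicator k (f ∘ suc) j<k))

  ∑-fibres : ∀ {X : Set} (s : X → ℕ) k (f : ℕ → ℤ) (xs : List X) → All (λ x → s x < k) xs →
    ∑[ i ∈ upTo k ] (+ length (filter (λ x → s x ≟ i) xs) * f i) ≡ ∑[ x ∈ xs ] f (s x)
  ∑-fibres s k f []       []              = ∑-zero (upTo k)
  ∑-fibres s k f (x ∷ xs) (sx<k ∷ bounds) = begin
    ∑[ i ∈ upTo k ] (+ length (filter (λ x → s x ≟ i) (x ∷ xs)) * f i)
      ≡⟨ ∑-cong (upTo k) split ⟩
    ∑[ i ∈ upTo k ] ((if does (s x ≟ i) then f i else 0ℤ) + + length (filter (λ x → s x ≟ i) xs) * f i)
      ≡⟨ ∑-+ (upTo k) _ _ ⟩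
    ∑[ i ∈ upTo k ] (if does (s x ≟ i) then f i else 0ℤ)
      + ∑[ i ∈ upTo k ] (+ length (filter (λ x → s x ≟ i) xs) * f i)
      ≡⟨ cong₂ _+_ (∑-upTo-indicator k f sx<k) (∑-fibres s k f xs bounds) ⟩
    f (s x) + ∑[ x ∈ xs ] f (s x) ∎
    where
    split : ∀ i → + length (filter (λ x → s x ≟ i) (x ∷ xs)) * f i
                  ≡ (if does (s x ≟ i) then f i else 0ℤ) + + length (filter (λ x → s x ≟ i) xs) * f i
    split i with does (s x ≟ i)
    ... | true  = one-more (+ length (filter (λ x → s x ≟ i) xs)) (f i)
      where
      one-more : ∀ l v → (1ℤ + l) * v ≡ v + l * v
      one-more = solve-∀
    ... | false = sym (+-identityˡ _)

  -- Inserting the largest letter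

  <⇒<ᵇ≡true : ∀ {m n} → m < n → (m <ᵇ n) ≡ true
  <⇒<ᵇ≡true = Equivalence.to T-≡ ∘ <⇒<ᵇ

  >⇒<ᵇ≡false : ∀ {m n} → n < m → (m <ᵇ n) ≡ false
  >⇒<ᵇ≡false {m} {n} n<m = ¬-not {y = true} (λ m<ᵇn → <-asym n<m (<ᵇ⇒< m n (Equivalence.from T-≡ m<ᵇn)))

  ascents-∷-< : ∀ {x y} ys → x < y → ascents (x ∷ y ∷ ys) ≡ suc (ascents (y ∷ ys))
  ascents-∷-< {y = y} ys x<y = cong (λ b → (if b then 1 else 0) ℕ.+ ascents (y ∷ ys)) (<⇒<ᵇ≡true x<y)

  ascents-∷-> : ∀ {x y} ys → y < x → ascents (x ∷ y ∷ ys) ≡ ascents (y ∷ ys)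
  ascents-∷-> {y = y} ys y<x = cong (λ b → (if b then 1 else 0) ℕ.+ ascents (y ∷ ys)) (>⇒<ᵇ≡false y<x)

  ascents<length : ∀ x xs → ascents (x ∷ xs) < length (x ∷ xs)
  ascents<length x []       = s≤s z≤n
  ascents<length x (y ∷ ys) with x <ᵇ y
  ... | true  = s≤s (ascents<length y ys)
  ... | false = m<n⇒m<1+n (ascents<length y ys)

  insertions-length : ∀ x σ → All (λ τ → length τ ≡ suc (length σ)) (insertions x σ)
  insertions-length x []       = refl ∷ []
  insertions-length x (y ∷ ys) = refl ∷ map⁺ (All.map (cong suc) (insertions-length x ys))

  insertions-All : ∀ {P : ℕ → Set} {x} σ → P x → All P σ → All (All P) (insertions x σ)
  insertions-All []       px []         = (px ∷ []) ∷ []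
  insertions-All (y ∷ ys) px (py ∷ pys) = (px ∷ py ∷ pys) ∷ map⁺ (All.map (py ∷_) (insertions-All ys px pys))

  perms-length : ∀ m → All (λ σ → length σ ≡ m) (perms m)
  perms-length zero    = refl ∷ []
  perms-length (suc m) = concat⁺ (map⁺ (All.map insert (perms-length m)))
    where
    insert : ∀ {σ} → length σ ≡ m → All (λ τ → length τ ≡ suc m) (insertions (suc m) σ)
    insert {σ} refl = insertions-length (suc m) σ

  perms-bounded : ∀ m → All (All (_< suc m)) (perms m)
  perms-bounded zero    = [] ∷ []
  perms-bounded (suc m) = concat⁺ (map⁺ (All.map insert (perms-bounded m)))
    where
    insert : ∀ {σ} → All (_< suc m) σ → All (All (_< suc (suc m))) (insertions (suc m) σ)
    insert {σ} σ≤m = insertions-All σ (n<1+n (suc m)) (All.map m<n⇒m<1+n σ≤m)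

  perms-ascents< : ∀ m → 1 ≤ m → All (λ σ → ascents σ < m) (perms m)
  perms-ascents< (suc m) _ = All.map (λ {σ} → bound {σ}) (perms-length (suc m))
    where
    bound : ∀ {σ} → length σ ≡ suc m → ascents σ < suc m
    bound {x ∷ xs} len = subst (ascents (x ∷ xs) <_) len (ascents<length x xs)

  -- Inserting x, larger than every letter of σ, at the front or into an ascent of σ keeps the
  -- number of ascents; inserting it at the end or into a descent adds one.
  module _ {x : ℕ} where

    ∑-insertions-after : ∀ y ys → y < x → All (_< x) ys → (g : ℕ → ℤ) →
      let a = ascents (y ∷ ys) in
      ∑[ τ ∈ insertions x ys ] g (ascents (y ∷ τ))
        ≡ + a * g a + (+ length (y ∷ ys) - + a) * g (suc a)
    ∑-insertions-after y [] y<x [] g =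
      trans (cong (λ a → g a + 0ℤ) (ascents-∷-< [] y<x)) (only-end (g 0) (g 1))
      where
      only-end : ∀ g₀ g₁ → g₁ + 0ℤ ≡ 0ℤ * g₀ + (+ 1 - 0ℤ) * g₁
      only-end = solve-∀
    ∑-insertions-after y (z ∷ zs) y<x (z<x ∷ zs<x) g = begin
      g (ascents (y ∷ x ∷ z ∷ zs)) + ∑[ τ ∈ map (z ∷_) (insertions x zs) ] g (ascents (y ∷ τ))
        ≡⟨ cong₂ _+_ (cong g (trans (ascents-∷-< (z ∷ zs) y<x) (cong suc (ascents-∷-> zs z<x))))
                     (∑-map (z ∷_) (insertions x zs) (λ τ → g (ascents (y ∷ τ)))) ⟩
      g (suc a′) + ∑[ ρ ∈ insertions x zs ] g (b ℕ.+ ascents (z ∷ ρ))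
        ≡⟨ cong (_+_ (g (suc a′))) (∑-insertions-after z zs z<x zs<x (λ a → g (b ℕ.+ a))) ⟩
      g (suc a′) + (+ a′ * g (b ℕ.+ a′) + (+ length (z ∷ zs) - + a′) * g (b ℕ.+ suc a′))
        ≡⟨ merge (y <ᵇ z) ⟩
      + a * g a + (+ length (y ∷ z ∷ zs) - + a) * g (suc a) ∎
      where
      a′ = ascents (z ∷ zs)
      b = if y <ᵇ z then 1 else 0
      a = ascents (y ∷ z ∷ zs)
      merge : ∀ c → let bit = if c then 1 else 0 in
        g (suc a′) + (+ a′ * g (bit ℕ.+ a′) + (+ length (z ∷ zs) - + a′) * g (bit ℕ.+ suc a′))
          ≡ + (bit ℕ.+ a′) * g (bit ℕ.+ a′) + (+ length (y ∷ z ∷ zs) - + (bit ℕ.+ a′)) * g (suc (bit ℕ.+ a′))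
      merge true  = ascent (+ a′) (+ length (z ∷ zs)) (g (suc a′)) (g (suc (suc a′)))
        where
        ascent : ∀ a L g₁ g₂ → g₁ + (a * g₁ + (L - a) * g₂) ≡ (1ℤ + a) * g₁ + ((1ℤ + L) - (1ℤ + a)) * g₂
        ascent = solve-∀
      merge false = descent (+ a′) (+ length (z ∷ zs)) (g a′) (g (suc a′))
        where
        descent : ∀ a L g₀ g₁ → g₁ + (a * g₀ + (L - a) * g₁) ≡ a * g₀ + ((1ℤ + L) - a) * g₁
        descent = solve-∀

    ∑-insertions : ∀ σ → All (_< x) σ → (g : ℕ → ℤ) →
      let a = ascents σ in
      ∑[ τ ∈ insertions x σ ] g (ascents τ) ≡ (1ℤ + + a) * g a + (+ length σ - + a) * g (suc a)
    ∑-insertions [] [] g = singleton (g 0) (g 1)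
      where
      singleton : ∀ g₀ g₁ → g₀ + 0ℤ ≡ (1ℤ + 0ℤ) * g₀ + (0ℤ - 0ℤ) * g₁
      singleton = solve-∀
    ∑-insertions (y ∷ ys) (y<x ∷ ys<x) g = begin
      g (ascents (x ∷ y ∷ ys)) + ∑[ τ ∈ map (y ∷_) (insertions x ys) ] g (ascents τ)
        ≡⟨ cong₂ _+_ (cong g (ascents-∷-> ys y<x)) (∑-map (y ∷_) (insertions x ys) (g ∘ ascents)) ⟩
      g a + ∑[ τ ∈ insertions x ys ] g (ascents (y ∷ τ))
        ≡⟨ cong (_+_ (g a)) (∑-insertions-after y ys y<x ys<x g) ⟩
      g a + (+ a * g a + (+ length (y ∷ ys) - + a) * g (suc a))
        ≡⟨ front (+ a) (+ length (y ∷ ys) - + a) (g a) (g (suc a)) ⟩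
      (1ℤ + + a) * g a + (+ length (y ∷ ys) - + a) * g (suc a) ∎
      where
      a = ascents (y ∷ ys)
      front : ∀ a d g₀ g₁ → g₀ + (a * g₀ + d * g₁) ≡ (1ℤ + a) * g₀ + d * g₁
      front = solve-∀

  ∑-perms-suc : ∀ m (g : ℕ → ℤ) →
    ∑[ σ ∈ perms (suc m) ] g (ascents σ)
      ≡ ∑[ σ ∈ perms m ] ((1ℤ + + ascents σ) * g (ascents σ) + (+ m - + ascents σ) * g (suc (ascents σ)))
  ∑-perms-suc m g = begin
    ∑ (concat (map (insertions (suc m)) (perms m))) (g ∘ ascents)
      ≡⟨ ∑-concat (map (insertions (suc m)) (perms m)) (g ∘ ascents) ⟩
    ∑[ τs ∈ map (insertions (suc m)) (perms m) ] ∑ τs (g ∘ ascents)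
      ≡⟨ ∑-map (insertions (suc m)) (perms m) (λ τs → ∑ τs (g ∘ ascents)) ⟩
    ∑[ σ ∈ perms m ] ∑ (insertions (suc m) σ) (g ∘ ascents)
      ≡⟨ ∑-cong-local (All.zipWith insert (perms-length m , perms-bounded m)) ⟩
    ∑[ σ ∈ perms m ] ((1ℤ + + ascents σ) * g (ascents σ) + (+ m - + ascents σ) * g (suc (ascents σ))) ∎
    where
    insert : ∀ {σ} → length σ ≡ m × All (_< suc m) σ →
             ∑ (insertions (suc m) σ) (g ∘ ascents)
               ≡ (1ℤ + + ascents σ) * g (ascents σ) + (+ m - + ascents σ) * g (suc (ascents σ))
    insert {σ} (refl , σ≤m) = ∑-insertions σ σ≤m g

  -- Moments of the centred ascent statistic

  -- y = n − 2ℓ for n = m + 1 and ℓ = a + 1: minus twice the deviation of a from its mean (m − 1)/2.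
  centred : ℕ → ℕ → ℤ
  centred m a = + suc m - + 2 * + suc a

  moment : ℕ → (ℤ → ℤ) → ℤ
  moment m h = ∑[ σ ∈ perms m ] h (centred m (ascents σ))

  -- Passing from m to m + 1 sends y to y + 1 with weight (n − y)/2 and to y − 1 with weight
  -- (n + y)/2 (see ∑-perms-suc); Eigen k φ says that φ n is an eigenvector of this step with
  -- eigenvalue n − k.
  Eigen : ℕ → (ℤ → ℤ → ℤ) → Set
  Eigen k φ = ∀ n y → (n - y) * φ (1ℤ + n) (y + 1ℤ) + (n + y) * φ (1ℤ + n) (y - 1ℤ) ≡ + 2 * ((n - + k) * φ n y)

  moment-eigen : ∀ {k φ} → Eigen k φ → ∀ m →
    moment (suc m) (φ (+ suc (suc m))) ≡ (+ suc m - + k) * moment m (φ (+ suc m))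
  moment-eigen {k} {φ} eigen m = *-cancelˡ-≡ (+ 2) _ _ (begin
    + 2 * moment (suc m) φ′
      ≡⟨ ∑-*ˡ (perms (suc m)) (+ 2) (φ′ ∘ centred (suc m) ∘ ascents) ⟨
    ∑[ σ ∈ perms (suc m) ] g (ascents σ)
      ≡⟨ ∑-perms-suc m g ⟩
    ∑[ σ ∈ perms m ] ((1ℤ + + ascents σ) * g (ascents σ) + (+ m - + ascents σ) * g (suc (ascents σ)))
      ≡⟨ ∑-cong (perms m) (step ∘ ascents) ⟩
    ∑[ σ ∈ perms m ] (+ 2 * (c * φ n (centred m (ascents σ))))
      ≡⟨ ∑-*ˡ (perms m) (+ 2) _ ⟩
    + 2 * ∑[ σ ∈ perms m ] (c * φ n (centred m (ascents σ)))
      ≡⟨ cong (+ 2 *_) (∑-*ˡ (perms m) c _) ⟩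
    + 2 * (c * moment m (φ n)) ∎)
    where
    n = + suc m
    c = n - + k
    φ′ = φ (1ℤ + n)
    g : ℕ → ℤ
    g a = + 2 * φ′ (centred (suc m) a)
    up : ∀ M a → (1ℤ + (1ℤ + M)) - + 2 * (1ℤ + a) ≡ ((1ℤ + M) - + 2 * (1ℤ + a)) + 1ℤ
    up = solve-∀
    down : ∀ M a → (1ℤ + (1ℤ + M)) - + 2 * (1ℤ + (1ℤ + a)) ≡ ((1ℤ + M) - + 2 * (1ℤ + a)) - 1ℤ
    down = solve-∀
    slot-counts : ∀ M a h₊ h₋ → (1ℤ + a) * (+ 2 * h₊) + (M - a) * (+ 2 * h₋)
              ≡ ((1ℤ + M) - ((1ℤ + M) - + 2 * (1ℤ + a))) * h₊ + ((1ℤ + M) + ((1ℤ + M) - + 2 * (1ℤ + a))) * h₋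
    slot-counts = solve-∀
    step : ∀ a → (1ℤ + + a) * g a + (+ m - + a) * g (suc a) ≡ + 2 * (c * φ n (centred m a))
    step a = begin
      (1ℤ + + a) * g a + (+ m - + a) * g (suc a)
        ≡⟨ cong₂ (λ u v → (1ℤ + + a) * (+ 2 * φ′ u) + (+ m - + a) * (+ 2 * φ′ v)) (up (+ m) (+ a)) (down (+ m) (+ a)) ⟩
      (1ℤ + + a) * (+ 2 * φ′ (y + 1ℤ)) + (+ m - + a) * (+ 2 * φ′ (y - 1ℤ))
        ≡⟨ slot-counts (+ m) (+ a) _ _ ⟩
      (n - y) * φ′ (y + 1ℤ) + (n + y) * φ′ (y - 1ℤ)
        ≡⟨ eigen n y ⟩
      + 2 * (c * φ n y) ∎
      where y = centred m a

  moment-one : ∀ m → moment m (λ _ → 1ℤ) ≡ + (m !)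
  moment-one zero    = refl
  moment-one (suc m) = begin
    moment (suc m) (λ _ → 1ℤ)          ≡⟨ moment-eigen {0} eigen m ⟩
    (+ suc m - + 0) * moment m (λ _ → 1ℤ) ≡⟨ cong₂ _*_ (+-identityʳ (+ suc m)) (moment-one m) ⟩
    + suc m * + (m !)                  ≡⟨ pos-* (suc m) (m !) ⟨
    + (suc m !)                        ∎
    where
    eigen : Eigen 0 (λ _ _ → 1ℤ)
    eigen = solve-∀

  -- The step from k − 1 to k has eigenvalue 0, so no base case has to be computed.
  moment-eigen-vanishes : ∀ {k φ} → Eigen (suc k) φ → ∀ m → suc k ≤ m → moment m (φ (+ suc m)) ≡ 0ℤ
  moment-eigen-vanishes {k} {φ} eigen (suc m) k<1+m with m≤n⇒m<n∨m≡n k<1+m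
  ... | inj₁ k<m = begin
    moment (suc m) (φ (+ suc (suc m)))            ≡⟨ moment-eigen eigen m ⟩
    (+ suc m - + suc k) * moment m (φ (+ suc m))  ≡⟨ cong ((+ suc m - + suc k) *_) (moment-eigen-vanishes eigen m (s≤s⁻¹ k<m)) ⟩
    (+ suc m - + suc k) * 0ℤ                      ≡⟨ *-zeroʳ (+ suc m - + suc k) ⟩
    0ℤ                                            ∎
  ... | inj₂ refl = begin
    moment (suc m) (φ (+ suc (suc m)))            ≡⟨ moment-eigen eigen m ⟩
    (+ suc m - + suc m) * moment m (φ (+ suc m))  ≡⟨ cong (_* moment m (φ (+ suc m))) (+-inverseʳ (+ suc m)) ⟩
    0ℤ * moment m (φ (+ suc m))                   ≡⟨⟩
    0ℤ                                            ∎

  weight : ℤ → ℤ → ℤ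
  weight n ℓ = ℓ * (n - + 2 * ℓ) * (n * n - + 4 * n * ℓ + + 4 * ℓ * ℓ - n)

  ∑-weight : ∀ m → 4 ≤ m → + 15 * ∑[ σ ∈ perms m ] weight (+ suc m) (+ suc (ascents σ)) ≡ + suc m * + (m !)
  ∑-weight m 4≤m = *-cancelˡ-≡ (+ 2) _ _ (begin
    + 2 * (+ 15 * ∑[ σ ∈ perms m ] w (ascents σ))
      ≡⟨ *-assoc (+ 2) (+ 15) _ ⟨
    + 30 * ∑[ σ ∈ perms m ] w (ascents σ)
      ≡⟨ ∑-*ˡ (perms m) (+ 30) (w ∘ ascents) ⟨
    ∑[ σ ∈ perms m ] (+ 30 * w (ascents σ))
      ≡⟨ ∑-cong (perms m) (λ σ → expansion n (+ suc (ascents σ))) ⟩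
    moment m (λ y → (+ 2 * n) * 1ℤ + (+ 15 * n) * (y * y * y - n * y) + (- (+ 5 * n)) * (+ 3 * y * y - n)
                    + (- 1ℤ) * (+ 15 * y * y * y * y - + 30 * n * y * y + + 5 * n * n + + 2 * n))
      ≡⟨ ∑-+-*-vanishing (perms m) _ _ (- 1ℤ) (moment-eigen-vanishes φ₄-eigen m 4≤m) ⟩
    moment m (λ y → (+ 2 * n) * 1ℤ + (+ 15 * n) * (y * y * y - n * y) + (- (+ 5 * n)) * (+ 3 * y * y - n))
      ≡⟨ ∑-+-*-vanishing (perms m) _ _ (- (+ 5 * n)) (moment-eigen-vanishes φ₂-eigen m (≤-trans (s≤s (s≤s z≤n)) 4≤m)) ⟩
    moment m (λ y → (+ 2 * n) * 1ℤ + (+ 15 * n) * (y * y * y - n * y))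
      ≡⟨ ∑-+-*-vanishing (perms m) _ _ (+ 15 * n) (moment-eigen-vanishes φ₃-eigen m (≤-trans (s≤s (s≤s (s≤s z≤n))) 4≤m)) ⟩
    moment m (λ _ → (+ 2 * n) * 1ℤ)
      ≡⟨ ∑-*ˡ (perms m) (+ 2 * n) _ ⟩
    (+ 2 * n) * moment m (λ _ → 1ℤ)
      ≡⟨ cong ((+ 2 * n) *_) (moment-one m) ⟩
    (+ 2 * n) * + (m !)
      ≡⟨ *-assoc (+ 2) n (+ (m !)) ⟩
    + 2 * (n * + (m !)) ∎)
    where
    n = + suc m
    w : ℕ → ℤ
    w a = weight n (+ suc a)
    expansion : ∀ n ℓ → let y = n - + 2 * ℓ in
      + 30 * (ℓ * (n - + 2 * ℓ) * (n * n - + 4 * n * ℓ + + 4 * ℓ * ℓ - n))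
        ≡ (+ 2 * n) * 1ℤ + (+ 15 * n) * (y * y * y - n * y) + (- (+ 5 * n)) * (+ 3 * y * y - n)
          + (- 1ℤ) * (+ 15 * y * y * y * y - + 30 * n * y * y + + 5 * n * n + + 2 * n)
    expansion = solve-∀
    φ₂-eigen : Eigen 2 (λ n y → + 3 * y * y - n)
    φ₂-eigen = solve-∀
    φ₃-eigen : Eigen 3 (λ n y → y * y * y - n * y)
    φ₃-eigen = solve-∀
    φ₄-eigen : Eigen 4 (λ n y → + 15 * y * y * y * y - + 30 * n * y * y + + 5 * n * n + + 2 * n)
    φ₄-eigen = solve-∀

open AscentSums
open import Data.Rational using (_+_; _*_; _-_; -_)

-- On a denominator suc d, ℚ's _/_ unfolds to fromℚᵘ (mkℚᵘ a d).
toℚᵘ-/ : ∀ a d → toℚᵘ (a / suc d) ≃ᵘ mkℚᵘ a d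
toℚᵘ-/ a d = toℚᵘ-fromℚᵘ (mkℚᵘ a d)

toℚᵘ≃mkℚᵘ⇒≡/ : ∀ {p} a d → toℚᵘ p ≃ᵘ mkℚᵘ a d → p ≡ a / suc d
toℚᵘ≃mkℚᵘ⇒≡/ a d p≃a/d = toℚᵘ-injective (≃-trans p≃a/d (≃-sym (toℚᵘ-/ a d)))

*≡*⇒/≡/ : ∀ a b c d .{{_ : NonZero c}} .{{_ : NonZero d}} → a ℤ.* + d ≡ b ℤ.* + c → a / c ≡ b / d
*≡*⇒/≡/ a b (suc c) (suc d) eq = toℚᵘ≃mkℚᵘ⇒≡/ b d (≃-trans (toℚᵘ-/ a c) (*≡* eq))

/-+-/ : ∀ a b d .{{_ : NonZero d}} → a / d + b / d ≡ (a ℤ.+ b) / d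
/-+-/ a b (suc d) = toℚᵘ≃mkℚᵘ⇒≡/ (a ℤ.+ b) d
  (≃-trans (toℚᵘ-homo-+ (a / suc d) (b / suc d))
  (≃-trans (ℚᵘ.+-cong (toℚᵘ-/ a d) (toℚᵘ-/ b d))
           (*≡* (trans (common-denominator a b (+ suc d)) (cong ((a ℤ.+ b) ℤ.*_) (sym (pos-* (suc d) (suc d))))))))
  where
  common-denominator : ∀ a b D → (a ℤ.* D ℤ.+ b ℤ.* D) ℤ.* D ≡ (a ℤ.+ b) ℤ.* (D ℤ.* D)
  common-denominator = solve-∀

-‿/ : ∀ a d .{{_ : NonZero d}} → - (a / d) ≡ (ℤ.- a) / d
-‿/ a (suc d) = toℚᵘ≃mkℚᵘ⇒≡/ (ℤ.- a) d (≃-trans (toℚᵘ-homo‿- (a / suc d)) (ℚᵘ.-‿cong (toℚᵘ-/ a d)))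

/-‿-/ : ∀ a b d .{{_ : NonZero d}} → a / d - b / d ≡ (a ℤ.- b) / d
/-‿-/ a b d = trans (cong (_+_ (a / d)) (-‿/ b d)) (/-+-/ a (ℤ.- b) d)

/-*-/1 : ∀ a b d .{{_ : NonZero d}} → (a / d) * (b / 1) ≡ (a ℤ.* b) / d
/-*-/1 a b (suc d) = toℚᵘ≃mkℚᵘ⇒≡/ (a ℤ.* b) d
  (≃-trans (toℚᵘ-homo-* (a / suc d) (b / 1))
  (≃-trans (ℚᵘ.*-cong (toℚᵘ-/ a d) (toℚᵘ-/ b 0))
           (*≡* (cong (λ e → a ℤ.* b ℤ.* + suc e) (sym (ℕ-*-identityʳ d))))))

foldr-+-/ : ∀ {A : Set} (xs : List A) (f : A → ℤ) d .{{_ : NonZero d}} →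
            foldr _+_ 0ℚ (map (λ x → f x / d) xs) ≡ (∑ xs f) / d
foldr-+-/ []       f d = sym (0/n≡0 d)
foldr-+-/ (x ∷ xs) f d = trans (cong (_+_ (f x / d)) (foldr-+-/ xs f d)) (/-+-/ (f x) (∑ xs f) d)

summand-as-fraction : ∀ a n ℓ d .{{_ : NonZero d}} →
  (a / d) * (+ ℓ / 1) * ((+ n / 1) - (+ (2 *ℕ ℓ) / 1))
    * ((+ (n *ℕ n) / 1) - (+ (4 *ℕ n *ℕ ℓ) / 1) + (+ (4 *ℕ ℓ *ℕ ℓ) / 1) - (+ n / 1))
  ≡ (a ℤ.* weight (+ n) (+ ℓ)) / d
summand-as-fraction a n ℓ d = begin
  (a / d) * (+ ℓ / 1) * ((+ n / 1) - (+ (2 *ℕ ℓ) / 1))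
    * ((+ (n *ℕ n) / 1) - (+ (4 *ℕ n *ℕ ℓ) / 1) + (+ (4 *ℕ ℓ *ℕ ℓ) / 1) - (+ n / 1))
    ≡⟨ cong₂ (λ u v → (a / d) * (+ ℓ / 1) * u * v) (/-‿-/ (+ n) (+ (2 *ℕ ℓ)) 1) quartic ⟩
  (a / d) * (+ ℓ / 1) * (y / 1) * (q / 1)
    ≡⟨ cong (λ u → u * (y / 1) * (q / 1)) (/-*-/1 a (+ ℓ) d) ⟩
  ((a ℤ.* + ℓ) / d) * (y / 1) * (q / 1)
    ≡⟨ cong (_* (q / 1)) (/-*-/1 (a ℤ.* + ℓ) y d) ⟩
  ((a ℤ.* + ℓ ℤ.* y) / d) * (q / 1)
    ≡⟨ /-*-/1 (a ℤ.* + ℓ ℤ.* y) q d ⟩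
  (a ℤ.* + ℓ ℤ.* y ℤ.* q) / d
    ≡⟨ /-cong numerator refl ⟩
  (a ℤ.* weight (+ n) (+ ℓ)) / d ∎
  where
  y = + n ℤ.- + (2 *ℕ ℓ)
  q = + (n *ℕ n) ℤ.- + (4 *ℕ n *ℕ ℓ) ℤ.+ + (4 *ℕ ℓ *ℕ ℓ) ℤ.- + n
  quartic : (+ (n *ℕ n) / 1) - (+ (4 *ℕ n *ℕ ℓ) / 1) + (+ (4 *ℕ ℓ *ℕ ℓ) / 1) - (+ n / 1) ≡ q / 1
  quartic = begin
    (+ (n *ℕ n) / 1) - (+ (4 *ℕ n *ℕ ℓ) / 1) + (+ (4 *ℕ ℓ *ℕ ℓ) / 1) - (+ n / 1)
      ≡⟨ cong (λ u → u + (+ (4 *ℕ ℓ *ℕ ℓ) / 1) - (+ n / 1)) (/-‿-/ (+ (n *ℕ n)) (+ (4 *ℕ n *ℕ ℓ)) 1) ⟩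
    ((+ (n *ℕ n) ℤ.- + (4 *ℕ n *ℕ ℓ)) / 1) + (+ (4 *ℕ ℓ *ℕ ℓ) / 1) - (+ n / 1)
      ≡⟨ cong (_- (+ n / 1)) (/-+-/ (+ (n *ℕ n) ℤ.- + (4 *ℕ n *ℕ ℓ)) (+ (4 *ℕ ℓ *ℕ ℓ)) 1) ⟩
    ((+ (n *ℕ n) ℤ.- + (4 *ℕ n *ℕ ℓ) ℤ.+ + (4 *ℕ ℓ *ℕ ℓ)) / 1) - (+ n / 1)
      ≡⟨ /-‿-/ (+ (n *ℕ n) ℤ.- + (4 *ℕ n *ℕ ℓ) ℤ.+ + (4 *ℕ ℓ *ℕ ℓ)) (+ n) 1 ⟩
    q / 1 ∎
  regroup : ∀ a ℓ y q → a ℤ.* ℓ ℤ.* y ℤ.* q ≡ a ℤ.* (ℓ ℤ.* y ℤ.* q)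
  regroup = solve-∀
  numerator : a ℤ.* + ℓ ℤ.* y ℤ.* q ≡ a ℤ.* weight (+ n) (+ ℓ)
  numerator = begin
    a ℤ.* + ℓ ℤ.* y ℤ.* q
      ≡⟨ cong₂ (λ u v → a ℤ.* + ℓ ℤ.* (+ n ℤ.- u) ℤ.* v) (pos-* 2 ℓ)
               (cong₂ (λ u v → u ℤ.+ v ℤ.- + n) (cong₂ ℤ._-_ (pos-* n n) (pos-*₃ 4 n ℓ)) (pos-*₃ 4 ℓ ℓ)) ⟩
    a ℤ.* + ℓ ℤ.* (+ n ℤ.- + 2 ℤ.* + ℓ) ℤ.* (+ n ℤ.* + n ℤ.- + 4 ℤ.* + n ℤ.* + ℓ ℤ.+ + 4 ℤ.* + ℓ ℤ.* + ℓ ℤ.- + n)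
      ≡⟨ regroup a (+ ℓ) _ _ ⟩
    a ℤ.* weight (+ n) (+ ℓ) ∎
    where
    pos-*₃ : ∀ a b c → + (a *ℕ b *ℕ c) ≡ + a ℤ.* + b ℤ.* + c
    pos-*₃ a b c = trans (pos-* (a *ℕ b) c) (cong (ℤ._* + c) (pos-* a b))

lemma3p8 : ∀ (n : ℕ) → 5 ≤ n →
  foldr _+_ 0ℚ
    (map (λ i → let ℓ = suc i in
            ((+ A (n ∸ 1) (ℓ ∸ 1)) / ((n ∸ 1) !)) {{(n ∸ 1) !≢0}}
              * (+ ℓ / 1)
              * ((+ n / 1) - (+ (2 *ℕ ℓ) / 1))
              * ((+ (n *ℕ n) / 1) - (+ (4 *ℕ n *ℕ ℓ) / 1)
                   + (+ (4 *ℕ ℓ *ℕ ℓ) / 1) - (+ n / 1)))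
         (upTo (n ∸ 1)))
    ≡ (+ n / 15)
lemma3p8 (suc m) (s≤s 4≤m) =
  trans (cong (foldr _+_ 0ℚ) (map-cong (λ i → summand-as-fraction (+ A m i) (suc m) (suc i) (m !)) (upTo m))) (begin
  foldr _+_ 0ℚ (map (λ i → (+ A m i ℤ.* w i) / m !) (upTo m))
    ≡⟨ foldr-+-/ (upTo m) (λ i → + A m i ℤ.* w i) (m !) ⟩
  (∑[ i ∈ upTo m ] (+ A m i ℤ.* w i)) / m !
    ≡⟨ /-cong (∑-fibres ascents m w (perms m) (perms-ascents< m (≤-trans (s≤s z≤n) 4≤m))) refl ⟩
  (∑[ σ ∈ perms m ] w (ascents σ)) / m !
    ≡⟨ *≡*⇒/≡/ (∑[ σ ∈ perms m ] w (ascents σ)) (+ suc m) (m !) 15 (trans (*-comm _ (+ 15)) (∑-weight m 4≤m)) ⟩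
  + suc m / 15 ∎)
  where
  instance
    m!≢0 : NonZero (m !)
    m!≢0 = m !≢0
  w : ℕ → ℤ
  w i = weight (+ suc m) (+ suc i)
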